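{- For every odd integer $n\ge 3$, $\chi_{la}(M_{2n})=3$.
   Context: For $n\ge 2$, the Möbius ladder $M_{2n}$ is obtained from the cycle $C_{2n}=u_1u_2\cdots u_nv_1v_2\cdots v_nu_1$ by adding the edges $u_iv_i$ for $1\le i\le n$. For a graph $G=(V,E)$, a local antimagic labeling is a bijection $f:E\to\{1,\dots,|E|\}$ such that, with $f^+(u)=\sum_{e\ni u} f(e)$, adjacent vertices receive distinct values of $f^+$; $c(f)$ is the number of distinct values of $f^+$ and $\chi_{la}(G)=\min c(f)$ over all local antimagic labelings. -}

module Defs where

open import Data.Nat using (ℕ; zero; suc; _+_; _*_; _∸_; _<_; _≤_; _<ᵇ_; _≟_)
open import Data.Nat.DivMod using (_%_)
open import Data.Fin using (Fin; toℕ)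
open import Data.Nat.ListAction using (sum)
open import Data.List using (List; map; length; allFin; upTo; deduplicate)
open import Data.Product using (_×_; _,_; proj₁; proj₂; Σ)
open import Data.Bool using (if_then_else_)
open import Data.Sum using (_⊎_)
open import Relation.Nullary using (¬_)
open import Relation.Nullary.Decidable using (_⊎-dec_; ⌊_⌋)
open import Relation.Binary.PropositionalEquality using (_≡_)
open import Function.Bundles using (_⤖_; Bijection)

-- Vertices: natural numbers 0 … 2n-1, where vertex j stands for
--   u_{j+1} if j < n, and v_{j-n+1} if n ≤ j < 2n.
-- So the cycle C_{2n} = u_1 … u_n v_1 … v_n u_1 is 0,1,…,2n-1,0.
-- Edges: indexed by Fin (3n).  Edge j with j < 2n is the cycle edge
-- {j, (j+1) mod 2n}; edge 2n+i (i < n) is the rung u_{i+1}v_{i+1} = {i, n+i}.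

ends : (n : ℕ) → ℕ → ℕ × ℕ
ends n j = if j <ᵇ 2 * n
             then (j , suc j % suc (2 * n ∸ 1))
             else (j ∸ 2 * n , n + (j ∸ 2 * n))

-- edge labelings: bijections E → {1,…,3n}; edge k gets label 1 + toℕ (f k)
Labeling : ℕ → Set
Labeling n = Fin (3 * n) ⤖ Fin (3 * n)

label : {n : ℕ} → Labeling n → Fin (3 * n) → ℕ
label f k = suc (toℕ (Bijection.to f k))

fplus : (n : ℕ) → Labeling n → ℕ → ℕ
fplus n f x =
  sum (map (λ k → if ⌊ (x ≟ proj₁ (ends n (toℕ k))) ⊎-dec (x ≟ proj₂ (ends n (toℕ k))) ⌋
                    then label {n} f k else 0)
           (allFin (3 * n)))

IsLocalAntimagic : (n : ℕ) → Labeling n → Set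
IsLocalAntimagic n f =
  (k : Fin (3 * n)) →
    ¬ (fplus n f (proj₁ (ends n (toℕ k))) ≡ fplus n f (proj₂ (ends n (toℕ k))))

colours : (n : ℕ) → Labeling n → ℕ
colours n f = length (deduplicate _≟_ (map (fplus n f) (upTo (2 * n))))

ChiLaMobiusIs : ℕ → ℕ → Set
ChiLaMobiusIs n c =
  Σ (Labeling n) (λ f → IsLocalAntimagic n f × colours n f ≡ c)
  × ((f : Labeling n) → IsLocalAntimagic n f → c ≤ colours n f)

module Submission where

-- For n odd, M_{2n} is bipartite: parity of the vertex index is a proper
-- 2-colouring, since rung i joins i and n + i.  Double counting the label of each edge
-- (handshake) shows that the f⁺-values of the even vertices and those of
-- the odd vertices both add up to the total label sum.  If a local antimagic labeling had
-- at most two colours, f⁺ would alternate between f⁺(0) and f⁺(1) along the Hamiltonian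
-- cycle, so n·f⁺(0) = n·f⁺(1), contradicting f⁺(0) ≠ f⁺(1).
--
-- For n = 2k + 1 ≥ 5 the odd cycle edges 2t+1, the even cycle edges 2t and
-- the rungs receive the label blocks 1..n, n+1..2n and 2n+1..3n, arranged by explicit
-- permutations τ and ρ of {0,…,n-1}.  The sum at a vertex is computed from its three
-- incident edges: it is 9k + 6 at odd vertices and 8k + 4 or 10k + 5 at even vertices.
-- For n = 3 an explicit labeling is checked by computation.

open import Defs
open import Data.Nat using (ℕ; zero; suc; _+_; _*_; _∸_; _<_; _≤_; _<ᵇ_; _≟_; _<?_; _≤?_; z≤n; s≤s; ⌊_/2⌋; >-nonZero)
open import Data.Nat.Properties
open import Data.Nat.DivMod using (_%_; m<n⇒m%n≡m; n%n≡0)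
open import Data.Nat.Tactic.RingSolver using (solve)
import Data.Nat.ListAction as ListAction
open import Data.Bool using (Bool; true; false; if_then_else_; not; T)
open import Data.Bool.Properties using (not-involutive; not-¬; T-≡)
open import Data.Fin using (Fin; toℕ; fromℕ<) renaming (zero to fzero; suc to fsuc)
open import Data.Fin.Properties using (toℕ<n; toℕ-fromℕ<; toℕ-injective)
open import Data.Fin.Patterns using (0F; 1F; 2F; 3F; 4F; 5F; 6F; 7F; 8F)
open import Data.Product using (_×_; _,_; proj₁; proj₂; Σ; ∃)
open import Data.Sum using (_⊎_; inj₁; inj₂)
open import Data.Unit using (tt)
open import Data.List using (List; []; _∷_; _++_; length; map; allFin; tabulate; upTo; deduplicate)
open import Data.List.Properties using (map-tabulate; length-++)
open import Data.List.Membership.Propositional using (_∈_)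
open import Data.List.Membership.Propositional.Properties
  using (∈-∃++; ∈-++⁻; ∈-++⁺ˡ; ∈-++⁺ʳ; ∈-map⁺; ∈-map⁻; ∈-upTo⁺; ∈-upTo⁻; ∈-deduplicate⁺; ∈-deduplicate⁻)
open import Data.List.Relation.Binary.Subset.Propositional using (_⊆_)
open import Data.List.Relation.Unary.Any using (here; there)
import Data.List.Relation.Unary.All as All
import Data.List.Relation.Unary.AllPairs as AllPairs
open import Data.List.Relation.Unary.Unique.Propositional using (Unique)
open import Data.List.Relation.Unary.Unique.DecPropositional.Properties using (deduplicate-!)
open import Function.Bundles using (_⇔_; mk⇔; Equivalence; mk↔ₛ′)
open import Function.Properties.Inverse using (↔⇒⤖)
open import Relation.Nullary using (¬_; Dec; yes; no; contradiction)
open import Relation.Nullary.Decidable using (⌊_⌋; _⊎-dec_; isYes≗does; dec-true; dec-false; does-⇔)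
open import Relation.Binary.PropositionalEquality
open ≡-Reasoning
open import Algebra.Properties.CommutativeMonoid.Sum +-0-commutativeMonoid
  using (sum-syntax; ∑-distrib-+; ∑-comm; sum-cong-≗; sum-replicate-zero)


if-true : ∀ {A : Set} {b} {u v : A} → b ≡ true → (if b then u else v) ≡ u
if-true refl = refl

if-false : ∀ {A : Set} {b} {u v : A} → b ≡ false → (if b then u else v) ≡ v
if-false refl = refl

if-yes : ∀ {A P : Set} (P? : Dec P) {u v : A} → P → (if ⌊ P? ⌋ then u else v) ≡ u
if-yes P? p = if-true (trans (isYes≗does P?) (dec-true P? p))

if-no : ∀ {A P : Set} (P? : Dec P) {u v : A} → ¬ P → (if ⌊ P? ⌋ then u else v) ≡ v
if-no P? ¬p = if-false (trans (isYes≗does P?) (dec-false P? ¬p))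

-- ends is defined with the boolean test _<ᵇ_.
<ᵇ-true : ∀ {m n} → m < n → (m <ᵇ n) ≡ true
<ᵇ-true m<n = Equivalence.to T-≡ (<⇒<ᵇ m<n)

<ᵇ-false : ∀ {m n} → n ≤ m → (m <ᵇ n) ≡ false
<ᵇ-false {m} {n} n≤m with m <ᵇ n in eq
... | false = refl
... | true  = contradiction (<ᵇ⇒< m n (subst T (sym eq) tt)) (≤⇒≯ n≤m)

⌊⌋-⇔ : ∀ {A B : Set} → A ⇔ B → (A? : Dec A) (B? : Dec B) → ⌊ A? ⌋ ≡ ⌊ B? ⌋
⌊⌋-⇔ A⇔B A? B? = trans (isYes≗does A?) (trans (does-⇔ A⇔B A? B?) (sym (isYes≗does B?)))

∸-by : ∀ a b {c} → c + b ≡ a → a ∸ b ≡ c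
∸-by _ b {c} refl = m+n∸n≡m c b

≤-by : ∀ {a c} d → a + d ≡ c → a ≤ c
≤-by {a} d refl = m≤m+n a d

3n≡2n+n : ∀ n → 3 * n ≡ 2 * n + n
3n≡2n+n n = solve (n ∷ [])

2n≡n+n : ∀ n → 2 * n ≡ n + n
2n≡n+n n = solve (n ∷ [])

1+2*<2* : ∀ {t n} → t < n → suc (2 * t) < 2 * n
1+2*<2* {t} {n} t<n = subst (_≤ 2 * n) (*-suc 2 t) (*-monoʳ-≤ 2 t<n)

half-< : ∀ {t n} → 2 * t < 2 * n → t < n
half-< {t} {n} = *-cancelˡ-< 2 t n

<2n⇒<3n : ∀ n {y} → y < 2 * n → y < 3 * n
<2n⇒<3n n {y} y<2n = <-≤-trans y<2n (m≤n+m (2 * n) n)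

mid<3n : ∀ {s n} → s < n → n + s < 3 * n
mid<3n {s} {n} s<n = <-≤-trans (+-monoʳ-< n s<n) (+-monoʳ-≤ n (m≤m+n n (n + 0)))

high<3n : ∀ {y n} → y < n → 2 * n + y < 3 * n
high<3n {y} {n} y<n = subst (2 * n + y <_) (sym (3n≡2n+n n)) (+-monoʳ-< (2 * n) y<n)

≤⇒<1+2* : ∀ {c k} → c ≤ k → c < suc (2 * k)
≤⇒<1+2* {c} {k} c≤k = s≤s (≤-trans c≤k (m≤m+n k (k + 0)))

above⇒≤ : ∀ {k a} → k + a < suc (2 * k) → a ≤ k
above⇒≤ {k} {a} t<n = +-cancelˡ-≤ k a k (≤-trans (≤-pred t<n) (≤-reflexive (2n≡n+n k)))

below-or-above : ∀ t k → (∃ λ s → suc (t + s) ≡ k) ⊎ (∃ λ a → k + a ≡ t)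
below-or-above t k with t <? k
... | yes t<k = inj₁ (m≤n⇒∃[o]m+o≡n t<k)
... | no  t≮k = inj₂ (m≤n⇒∃[o]m+o≡n (≮⇒≥ t≮k))

data Split (m r : ℕ) : ℕ → Set where
  low  : ∀ {x} → x < m → Split m r x
  high : ∀ i → i < r → Split m r (m + i)

split : ∀ m r x → x < m + r → Split m r x
split m r x x<m+r with x <? m
... | yes x<m = low x<m
... | no x≮m with m≤n⇒∃[o]m+o≡n (≮⇒≥ x≮m)
...   | i , refl = high i (+-cancelˡ-< m i r x<m+r)

even : ℕ → Bool
even zero    = true
even (suc x) = not (even x)

even-+ : ∀ m x → even (m + x) ≡ (if even m then even x else not (even x))
even-+ zero    x = refl
even-+ (suc m) x with even m | even-+ m x
... | true  | e = cong not e
... | false | e = trans (cong not e) (not-involutive (even x))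

even-2* : ∀ t → even (2 * t) ≡ true
even-2* zero    = refl
even-2* (suc t) = trans (cong even (*-suc 2 t)) (trans (not-involutive (even (2 * t))) (even-2* t))

even-1+2* : ∀ t → even (suc (2 * t)) ≡ false
even-1+2* t = cong not (even-2* t)

odd⇒1≤n : ∀ {n} → even n ≡ false → 1 ≤ n
odd⇒1≤n {zero}  ()
odd⇒1≤n {suc n} _ = s≤s z≤n

data EvenOdd : ℕ → Set where
  even-form : ∀ t → EvenOdd (2 * t)
  odd-form  : ∀ t → EvenOdd (suc (2 * t))

evenOdd : ∀ x → EvenOdd x
evenOdd zero = even-form 0
evenOdd (suc x) with evenOdd x
... | even-form t = odd-form t
... | odd-form t  = subst EvenOdd (*-suc 2 t) (even-form (suc t))

⌊2*t/2⌋ : ∀ t → ⌊ 2 * t /2⌋ ≡ t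
⌊2*t/2⌋ zero    = refl
⌊2*t/2⌋ (suc t) = trans (cong ⌊_/2⌋ (*-suc 2 t)) (cong suc (⌊2*t/2⌋ t))

⌊1+2*t/2⌋ : ∀ t → ⌊ suc (2 * t) /2⌋ ≡ t
⌊1+2*t/2⌋ zero    = refl
⌊1+2*t/2⌋ (suc t) = trans (cong (λ y → ⌊ suc y /2⌋) (*-suc 2 t)) (cong suc (⌊1+2*t/2⌋ t))

when : Bool → ℕ → ℕ
when b v = if b then v else 0

when-⊎ : ∀ {A B : Set} (A? : Dec A) (B? : Dec B) v → ¬ (A × B) →
         when ⌊ A? ⊎-dec B? ⌋ v ≡ when ⌊ A? ⌋ v + when ⌊ B? ⌋ v
when-⊎ (yes a) (yes b) v ¬ab = contradiction (a , b) ¬ab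
when-⊎ (yes _) (no _)  v _   = sym (+-identityʳ v)
when-⊎ (no _)  (yes _) v _   = refl
when-⊎ (no _)  (no _)  v _   = refl

when-comm : ∀ a b v → when a (when b v) ≡ when b (when a v)
when-comm true  true  v = refl
when-comm true  false v = refl
when-comm false true  v = refl
when-comm false false v = refl

when-not : ∀ a v → when a v + when (not a) v ≡ v
when-not true  v = +-identityʳ v
when-not false v = refl

when-if : ∀ β {v a b} → v ≡ (if β then a else b) → when β v ≡ when β a × when (not β) v ≡ when (not β) b
when-if true  v≡a = v≡a , refl
when-if false v≡b = refl , v≡b

sum-tabulate : ∀ m (h : Fin m → ℕ) → ListAction.sum (tabulate h) ≡ ∑[ i < m ] h i
sum-tabulate zero    h = refl
sum-tabulate (suc m) h = cong (h fzero +_) (sum-tabulate m (λ i → h (fsuc i)))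

sum-allFin : ∀ m (h : Fin m → ℕ) → ListAction.sum (map h (allFin m)) ≡ ∑[ i < m ] h i
sum-allFin m h = trans (cong ListAction.sum (map-tabulate (λ i → i) h)) (sum-tabulate m h)

∑-when : ∀ {m} b (h : Fin m → ℕ) → when b (∑[ i < m ] h i) ≡ ∑[ i < m ] when b (h i)
∑-when     true  h = refl
∑-when {m} false h = sym (sum-replicate-zero m)

∑-δ : ∀ m p (g : ℕ → ℕ) → p < m → ∑[ i < m ] when ⌊ toℕ i ≟ p ⌋ (g (toℕ i)) ≡ g p
∑-δ (suc m) zero    g _         = trans (cong (g 0 +_) (sum-replicate-zero m)) (+-identityʳ (g 0))
∑-δ (suc m) (suc p) g (s≤s p<m) =
  trans (sum-cong-≗ {m} (λ i → cong (λ b → when b (g (suc (toℕ i)))) (≟-suc (toℕ i))))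
        (∑-δ m p (λ x → g (suc x)) p<m)
  where
  ≟-suc : ∀ a → ⌊ suc a ≟ suc p ⌋ ≡ ⌊ a ≟ p ⌋
  ≟-suc a = ⌊⌋-⇔ (mk⇔ suc-injective (cong suc)) (suc a ≟ suc p) (a ≟ p)

-- Half of 0, …, 2m-1 are even.
∑-parity : ∀ m (g : Bool → ℕ) → ∑[ x < 2 * m ] g (even (toℕ x)) ≡ m * (g true + g false)
∑-parity zero    g = refl
∑-parity (suc m) g = begin
  ∑[ x < 2 * suc m ] g (even (toℕ x))
    ≡⟨ cong (λ N → ∑[ x < N ] g (even (toℕ x))) (*-suc 2 m) ⟩
  g true + (g false + ∑[ x < 2 * m ] g (not (not (even (toℕ x)))))
    ≡⟨ cong (λ s → g true + (g false + s)) (sum-cong-≗ {2 * m} (λ x → cong g (not-involutive (even (toℕ x))))) ⟩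
  g true + (g false + ∑[ x < 2 * m ] g (even (toℕ x)))
    ≡⟨ cong (λ s → g true + (g false + s)) (∑-parity m g) ⟩
  g true + (g false + m * (g true + g false))
    ≡⟨ sym (+-assoc (g true) (g false) _) ⟩
  suc m * (g true + g false) ∎

unique⊆⇒length≤ : ∀ {xs ys : List ℕ} → Unique xs → xs ⊆ ys → length xs ≤ length ys
unique⊆⇒length≤ {[]}     _              _     = z≤n
unique⊆⇒length≤ {x ∷ xs} (x∉xs AllPairs.∷ uniq) xs⊆ys with ∈-∃++ (xs⊆ys (here refl))
... | us , vs , refl = subst (suc (length xs) ≤_) length-insert (s≤s (unique⊆⇒length≤ uniq xs⊆us++vs))
  where
  xs⊆us++vs : xs ⊆ us ++ vs
  xs⊆us++vs {z} z∈xs with ∈-++⁻ us (xs⊆ys (there z∈xs))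
  ... | inj₁ z∈us         = ∈-++⁺ˡ z∈us
  ... | inj₂ (here z≡x)   = contradiction (sym z≡x) (All.lookup x∉xs z∈xs)
  ... | inj₂ (there z∈vs) = ∈-++⁺ʳ us z∈vs
  length-insert : suc (length (us ++ vs)) ≡ length (us ++ x ∷ vs)
  length-insert = begin
    suc (length (us ++ vs))      ≡⟨ cong suc (length-++ us) ⟩
    suc (length us + length vs)  ≡⟨ sym (+-suc (length us) (length vs)) ⟩
    length us + length (x ∷ vs)  ≡⟨ sym (length-++ us) ⟩
    length (us ++ x ∷ vs)        ∎

-- The Möbius ladder.  Vertex x < 2n; cycle edge j < 2n joins j and next n j; rung
-- 2n + i joins i and n + i.  The three edges at x are x, prev n x and 2n + rung n x.
next : ℕ → ℕ → ℕ
next n j = if ⌊ suc j <? 2 * n ⌋ then suc j else 0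

prev : ℕ → ℕ → ℕ
prev n zero    = 2 * n ∸ 1
prev n (suc x) = x

rung : ℕ → ℕ → ℕ
rung n x = if ⌊ x <? n ⌋ then x else x ∸ n

suc-2n∸1 : ∀ n {j} → j < 2 * n → suc (2 * n ∸ 1) ≡ 2 * n
suc-2n∸1 n j<2n = m+[n∸m]≡n (≤-trans (s≤s z≤n) j<2n)

last≡ : ∀ n {j} → j < 2 * n → ¬ suc j < 2 * n → suc j ≡ 2 * n
last≡ n j<2n sj≮2n with m≤n⇒m<n∨m≡n j<2n
... | inj₁ sj<2n = contradiction sj<2n sj≮2n
... | inj₂ sj≡2n = sj≡2n

next-suc : ∀ n {j} → suc j < 2 * n → next n j ≡ suc j
next-suc n {j} sj<2n = if-yes (suc j <? 2 * n) sj<2n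

ends-cycle : ∀ n j → j < 2 * n → ends n j ≡ (j , next n j)
ends-cycle n j j<2n = trans (if-true (<ᵇ-true j<2n)) (cong (j ,_) wrap)
  where
  wrap : suc j % suc (2 * n ∸ 1) ≡ next n j
  wrap with suc j <? 2 * n
  ... | yes sj<2n = m<n⇒m%n≡m (≤-trans sj<2n (≤-reflexive (sym (suc-2n∸1 n j<2n))))
  ... | no sj≮2n  = trans (cong (_% suc (2 * n ∸ 1)) (trans (last≡ n j<2n sj≮2n) (sym (suc-2n∸1 n j<2n))))
                          (n%n≡0 (suc (2 * n ∸ 1)))

ends-rung : ∀ n i → ends n (2 * n + i) ≡ (i , n + i)
ends-rung n i = trans (if-false (<ᵇ-false (m≤m+n (2 * n) i))) (cong (λ y → y , n + y) (m+n∸m≡n (2 * n) i))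

prev-next : ∀ n j → j < 2 * n → prev n (next n j) ≡ j
prev-next n j j<2n with suc j <? 2 * n
... | yes _    = refl
... | no sj≮2n = cong (_∸ 1) (sym (last≡ n j<2n sj≮2n))

next-prev : ∀ n x → x < 2 * n → next n (prev n x) ≡ x
next-prev n zero 0<2n with suc (2 * n ∸ 1) <? 2 * n
... | yes p = contradiction (subst (_< 2 * n) (suc-2n∸1 n 0<2n) p) (<-irrefl refl)
... | no _  = refl
next-prev n (suc x) x<2n with suc x <? 2 * n
... | yes _ = refl
... | no ¬p = contradiction x<2n ¬p

prev< : ∀ n x → x < 2 * n → prev n x < 2 * n
prev< n zero    0<2n = ≤-reflexive (suc-2n∸1 n 0<2n)
prev< n (suc x) x<2n = <-trans (n<1+n x) x<2n

prev≢ : ∀ n x → x < 2 * n → x ≢ prev n x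
prev≢ (suc n) zero    _ e = m+1+n≢0 n (sym e)
prev≢ (suc n) (suc x) _ e = 1+n≢n e

rung-low : ∀ {n x} → x < n → rung n x ≡ x
rung-low {n} {x} x<n = if-yes (x <? n) x<n

rung-high : ∀ n i → rung n (n + i) ≡ i
rung-high n i = trans (if-no (n + i <? n) (≤⇒≯ (m≤m+n n i))) (m+n∸m≡n n i)

rung< : ∀ n x → x < 2 * n → rung n x < n
rung< n x x<2n with split n n x (subst (x <_) (2n≡n+n n) x<2n)
... | low x<n    = subst (_< n) (sym (rung-low x<n)) x<n
... | high i i<n = subst (_< n) (sym (rung-high n i)) i<n

Incident : ℕ → ℕ → ℕ → Set
Incident n x j = x ≡ proj₁ (ends n j) ⊎ x ≡ proj₂ (ends n j)

EdgeAt : ℕ → ℕ → ℕ → Set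
EdgeAt n x j = j ≡ x ⊎ j ≡ prev n x ⊎ j ≡ 2 * n + rung n x

incident⇔ : ∀ n {x j} → x < 2 * n → j < 3 * n → Incident n x j ⇔ EdgeAt n x j
incident⇔ n {x} {j} x<2n j<3n with split (2 * n) n j (subst (j <_) (3n≡2n+n n) j<3n)
... | low j<2n rewrite ends-cycle n j j<2n = mk⇔ to from
  where
  to : x ≡ j ⊎ x ≡ next n j → EdgeAt n x j
  to (inj₁ x≡j)    = inj₁ (sym x≡j)
  to (inj₂ x≡next) = inj₂ (inj₁ (trans (sym (prev-next n j j<2n)) (cong (prev n) (sym x≡next))))
  from : EdgeAt n x j → x ≡ j ⊎ x ≡ next n j
  from (inj₁ j≡x)           = inj₁ (sym j≡x)
  from (inj₂ (inj₁ j≡prev)) = inj₂ (trans (sym (next-prev n x x<2n)) (cong (next n) (sym j≡prev)))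
  from (inj₂ (inj₂ j≡rung)) = contradiction (subst (_< 2 * n) j≡rung j<2n) (≤⇒≯ (m≤m+n (2 * n) _))
... | high i i<n rewrite ends-rung n i = mk⇔ to from
  where
  to : x ≡ i ⊎ x ≡ n + i → EdgeAt n x (2 * n + i)
  to (inj₁ refl) = inj₂ (inj₂ (cong (2 * n +_) (sym (rung-low i<n))))
  to (inj₂ refl) = inj₂ (inj₂ (cong (2 * n +_) (sym (rung-high n i))))
  beyond : ∀ {y} → y < 2 * n → 2 * n + i ≢ y
  beyond y<2n e = contradiction (subst (_< 2 * n) (sym e) y<2n) (≤⇒≯ (m≤m+n (2 * n) i))
  from : EdgeAt n x (2 * n + i) → x ≡ i ⊎ x ≡ n + i
  from (inj₁ e)        = contradiction e (beyond x<2n)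
  from (inj₂ (inj₁ e)) = contradiction e (beyond (prev< n x x<2n))
  from (inj₂ (inj₂ e)) with split n n x (subst (x <_) (2n≡n+n n) x<2n) | +-cancelˡ-≡ (2 * n) i _ e
  ... | low x<n   | i≡r = inj₁ (trans (sym (rung-low x<n)) (sym i≡r))
  ... | high i′ _ | i≡r = inj₂ (cong (n +_) (trans (sym (rung-high n i′)) (sym i≡r)))

edge-parity : ∀ n → even n ≡ false → ∀ j → j < 3 * n →
  proj₁ (ends n j) < 2 * n × proj₂ (ends n j) < 2 * n × even (proj₁ (ends n j)) ≡ not (even (proj₂ (ends n j)))
edge-parity n n-odd j j<3n with split (2 * n) n j (subst (j <_) (3n≡2n+n n) j<3n)
... | low j<2n rewrite ends-cycle n j j<2n with suc j <? 2 * n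
...   | yes sj<2n = j<2n , sj<2n , sym (not-involutive (even j))
...   | no sj≮2n  = j<2n , ≤-trans (s≤s z≤n) j<2n ,
                    trans (sym (not-involutive (even j))) (cong not (trans (cong even (last≡ n j<2n sj≮2n)) (even-2* n)))
edge-parity n n-odd j j<3n | high i i<n rewrite ends-rung n i =
  <-≤-trans i<n (m≤m+n n (n + 0)) ,
  subst (n + i <_) (sym (2n≡n+n n)) (+-monoʳ-< n i<n) ,
  sym (trans (cong not (trans (even-+ n i) (if-false n-odd))) (not-involutive (even i)))

degree : ∀ {m} → (Fin m → ℕ × ℕ) → (Fin m → ℕ) → ℕ → ℕ
degree {m} e w x = ∑[ i < m ] when ⌊ (x ≟ proj₁ (e i)) ⊎-dec (x ≟ proj₂ (e i)) ⌋ (w i)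

fplus≡degree : ∀ n (f : Labeling n) x → fplus n f x ≡ degree (λ i → ends n (toℕ i)) (label {n} f) x
fplus≡degree n f x = sum-allFin (3 * n) _

Separates : ∀ {m} → ℕ → (Fin m → ℕ × ℕ) → (ℕ → Bool) → Set
Separates V e σ = ∀ i → proj₁ (e i) < V × proj₂ (e i) < V × σ (proj₁ (e i)) ≡ not (σ (proj₂ (e i)))

handshake : ∀ V {m} (e : Fin m → ℕ × ℕ) (w : Fin m → ℕ) (σ : ℕ → Bool) → Separates V e σ →
  ∑[ x < V ] when (σ (toℕ x)) (degree e w (toℕ x)) ≡ ∑[ i < m ] w i
handshake V {m} e w σ split-edge = begin
  ∑[ x < V ] when (σ (toℕ x)) (degree e w (toℕ x))
    ≡⟨ sum-cong-≗ {V} (λ x → ∑-when {m} (σ (toℕ x)) _) ⟩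
  ∑[ x < V ] ∑[ i < m ] when (σ (toℕ x)) (incidence x i)
    ≡⟨ ∑-comm {V} {m} (λ x i → when (σ (toℕ x)) (incidence x i)) ⟩
  ∑[ i < m ] ∑[ x < V ] when (σ (toℕ x)) (incidence x i)
    ≡⟨ sum-cong-≗ {m} edge ⟩
  ∑[ i < m ] w i ∎
  where
  incidence : Fin V → Fin m → ℕ
  incidence x i = when ⌊ (toℕ x ≟ proj₁ (e i)) ⊎-dec (toℕ x ≟ proj₂ (e i)) ⌋ (w i)
  -- each edge is counted once, at its selected end
  edge : ∀ i → ∑[ x < V ] when (σ (toℕ x)) (incidence x i) ≡ w i
  edge i with proj₁ (e i) | proj₂ (e i) | split-edge i
  ... | p | q | p<V , q<V , σp≡¬σq = begin
    ∑[ x < V ] when (σ (toℕ x)) (when ⌊ (toℕ x ≟ p) ⊎-dec (toℕ x ≟ q) ⌋ (w i))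
      ≡⟨ sum-cong-≗ {V} (λ x → trans (when-comm (σ (toℕ x)) _ (w i)) (when-⊎ (toℕ x ≟ p) (toℕ x ≟ q) _ p≢q)) ⟩
    ∑[ x < V ] (when ⌊ toℕ x ≟ p ⌋ (g (toℕ x)) + when ⌊ toℕ x ≟ q ⌋ (g (toℕ x)))
      ≡⟨ ∑-distrib-+ {V} (λ x → when ⌊ toℕ x ≟ p ⌋ (g (toℕ x))) _ ⟩
    ∑[ x < V ] when ⌊ toℕ x ≟ p ⌋ (g (toℕ x)) + ∑[ x < V ] when ⌊ toℕ x ≟ q ⌋ (g (toℕ x))
      ≡⟨ cong₂ _+_ (∑-δ V p g p<V) (∑-δ V q g q<V) ⟩
    when (σ p) (w i) + when (σ q) (w i)
      ≡⟨ cong (λ b → when b (w i) + when (σ q) (w i)) σp≡¬σq ⟩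
    when (not (σ q)) (w i) + when (σ q) (w i)
      ≡⟨ +-comm (when (not (σ q)) (w i)) _ ⟩
    when (σ q) (w i) + when (not (σ q)) (w i)
      ≡⟨ when-not (σ q) (w i) ⟩
    w i ∎
    where
    g : ℕ → ℕ
    g y = when (σ y) (w i)
    p≢q : ∀ {y} → ¬ (y ≡ p × y ≡ q)
    p≢q (y≡p , y≡q) = not-¬ (cong σ (trans (sym y≡p) y≡q)) σp≡¬σq

vertex-sum : ∀ n (f : Labeling n) (c : ℕ → ℕ) → (∀ i → label {n} f i ≡ c (toℕ i)) →
  ∀ x → x < 2 * n → fplus n f x ≡ c x + (c (prev n x) + c (2 * n + rung n x))
vertex-sum n f c label≡c x x<2n = begin
  fplus n f x
    ≡⟨ fplus≡degree n f x ⟩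
  ∑[ i < 3 * n ] when ⌊ (x ≟ proj₁ (ends n (toℕ i))) ⊎-dec (x ≟ proj₂ (ends n (toℕ i))) ⌋ (label {n} f i)
    ≡⟨ sum-cong-≗ {3 * n} three-edges ⟩
  ∑[ i < 3 * n ] (δ x i + (δ (prev n x) i + δ r i))
    ≡⟨ ∑-distrib-+ {3 * n} (δ x) _ ⟩
  ∑[ i < 3 * n ] δ x i + ∑[ i < 3 * n ] (δ (prev n x) i + δ r i)
    ≡⟨ cong (∑[ i < 3 * n ] δ x i +_) (∑-distrib-+ {3 * n} (δ (prev n x)) (δ r)) ⟩
  ∑[ i < 3 * n ] δ x i + (∑[ i < 3 * n ] δ (prev n x) i + ∑[ i < 3 * n ] δ r i)
    ≡⟨ cong₂ _+_ (∑-δ (3 * n) x c (<2n⇒<3n n x<2n))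
                 (cong₂ _+_ (∑-δ (3 * n) (prev n x) c (<2n⇒<3n n (prev< n x x<2n)))
                            (∑-δ (3 * n) r c (high<3n (rung< n x x<2n)))) ⟩
  c x + (c (prev n x) + c r) ∎
  where
  r : ℕ
  r = 2 * n + rung n x
  δ : ℕ → Fin (3 * n) → ℕ
  δ p i = when ⌊ toℕ i ≟ p ⌋ (c (toℕ i))
  below-r : ∀ {y} → y < 2 * n → y ≢ r
  below-r y<2n y≡r = ≤⇒≯ (m≤m+n (2 * n) (rung n x)) (subst (_< 2 * n) y≡r y<2n)
  three-edges : ∀ i → when ⌊ (x ≟ proj₁ (ends n (toℕ i))) ⊎-dec (x ≟ proj₂ (ends n (toℕ i))) ⌋ (label {n} f i)
                    ≡ δ x i + (δ (prev n x) i + δ r i)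
  three-edges i = begin
    when ⌊ (x ≟ proj₁ (ends n j)) ⊎-dec (x ≟ proj₂ (ends n j)) ⌋ (label {n} f i)
      ≡⟨ cong₂ when (⌊⌋-⇔ (incident⇔ n x<2n (toℕ<n i)) _ ((j ≟ x) ⊎-dec ((j ≟ prev n x) ⊎-dec (j ≟ r))))
                    (label≡c i) ⟩
    when ⌊ (j ≟ x) ⊎-dec ((j ≟ prev n x) ⊎-dec (j ≟ r)) ⌋ (c j)
      ≡⟨ when-⊎ (j ≟ x) _ (c j) (λ { (j≡x , inj₁ j≡prev) → prev≢ n x x<2n (trans (sym j≡x) j≡prev)
                                    ; (j≡x , inj₂ j≡r)    → below-r x<2n (trans (sym j≡x) j≡r) }) ⟩
    δ x i + when ⌊ (j ≟ prev n x) ⊎-dec (j ≟ r) ⌋ (c j)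
      ≡⟨ cong (δ x i +_) (when-⊎ (j ≟ prev n x) (j ≟ r) (c j)
                           (λ (j≡prev , j≡r) → below-r (prev< n x x<2n) (trans (sym j≡prev) j≡r))) ⟩
    δ x i + (δ (prev n x) i + δ r i) ∎
    where
    j : ℕ
    j = toℕ i

module LowerBound (n : ℕ) (n-odd : even n ≡ false) (f : Labeling n) (anti : IsLocalAntimagic n f) where

  F : ℕ → ℕ
  F = fplus n f

  1<2n : 1 < 2 * n
  1<2n = +-mono-≤ (odd⇒1≤n {n} n-odd) (≤-trans (odd⇒1≤n {n} n-odd) (m≤m+n n 0))

  class-sum : ∀ (σ : ℕ → Bool) → (∀ p q → even p ≡ not (even q) → σ p ≡ not (σ q)) →
              ∑[ x < 2 * n ] when (σ (toℕ x)) (F (toℕ x)) ≡ ∑[ i < 3 * n ] label {n} f i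
  class-sum σ σ-respects =
    trans (sum-cong-≗ {2 * n} (λ x → cong (when (σ (toℕ x))) (fplus≡degree n f (toℕ x))))
          (handshake (2 * n) (λ i → ends n (toℕ i)) (label {n} f) σ separated)
    where
    separated : Separates (2 * n) (λ i → ends n (toℕ i)) σ
    separated i with edge-parity n n-odd (toℕ i) (toℕ<n i)
    ... | p<2n , q<2n , parity = p<2n , q<2n , σ-respects _ _ parity

  -- consecutive vertices of the cycle are adjacent
  adjacent : ∀ j → suc j < 2 * n → F j ≢ F (suc j)
  adjacent j sj<2n Fj≡Fsj = anti (fromℕ< j<3n) (subst (λ e → F (proj₁ e) ≡ F (proj₂ e)) (sym ends≡) Fj≡Fsj)
    where
    j<3n : j < 3 * n
    j<3n = <-≤-trans (<-trans (n<1+n j) sj<2n) (m≤n+m (2 * n) n)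
    ends≡ : ends n (toℕ (fromℕ< j<3n)) ≡ (j , suc j)
    ends≡ = trans (cong (ends n) (toℕ-fromℕ< j<3n))
                  (trans (ends-cycle n j (<-trans (n<1+n j) sj<2n)) (cong (j ,_) (next-suc n sj<2n)))

  alternating : (∀ x → x < 2 * n → F x ≡ F 0 ⊎ F x ≡ F 1) →
                ∀ x → x < 2 * n → F x ≡ (if even x then F 0 else F 1)
  alternating two zero    _     = refl
  alternating two (suc x) sx<2n
    with two (suc x) sx<2n | alternating two x (<-trans (n<1+n x) sx<2n) | adjacent x sx<2n
  ... | inj₁ Fsx≡F0 | Fx≡ | Fx≢Fsx with even x
  ...   | true  = contradiction (trans Fx≡ (sym Fsx≡F0)) Fx≢Fsx
  ...   | false = Fsx≡F0
  alternating two (suc x) sx<2n | inj₂ Fsx≡F1 | Fx≡ | Fx≢Fsx with even x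
  ...   | true  = Fsx≡F1
  ...   | false = contradiction (trans Fx≡ (sym Fsx≡F1)) Fx≢Fsx

  two-values : colours n f < 3 → ∀ x → x < 2 * n → F x ≡ F 0 ⊎ F x ≡ F 1
  two-values few x x<2n with F x ≟ F 0 | F x ≟ F 1
  ... | yes Fx≡F0 | _         = inj₁ Fx≡F0
  ... | no _      | yes Fx≡F1 = inj₂ Fx≡F1
  ... | no Fx≢F0  | no Fx≢F1  = contradiction (unique⊆⇒length≤ unique three⊆values) (<⇒≱ few)
    where
    values : List ℕ
    values = deduplicate _≟_ (map F (upTo (2 * n)))
    value : ∀ {y} → y < 2 * n → F y ∈ values
    value y<2n = ∈-deduplicate⁺ _≟_ (∈-map⁺ F (∈-upTo⁺ y<2n))
    open All using ([]; _∷_)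
    open AllPairs using ([]; _∷_)
    unique : Unique (F 0 ∷ F 1 ∷ F x ∷ [])
    unique = (adjacent 0 1<2n ∷ (λ e → Fx≢F0 (sym e)) ∷ []) ∷ ((λ e → Fx≢F1 (sym e)) ∷ []) ∷ [] ∷ []
    three⊆values : (F 0 ∷ F 1 ∷ F x ∷ []) ⊆ values
    three⊆values (here refl)                 = value (<-trans (s≤s z≤n) 1<2n)
    three⊆values (there (here refl))         = value 1<2n
    three⊆values (there (there (here refl))) = value x<2n

  -- An alternating f⁺ gives the even and the odd side the sums n·f⁺(0) and n·f⁺(1);
  -- both equal the total label sum, so f⁺(0) = f⁺(1).
  F0≡F1 : (∀ x → x < 2 * n → F x ≡ (if even x then F 0 else F 1)) → F 0 ≡ F 1
  F0≡F1 alt = begin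
    F 0      ≡⟨ sym (+-identityʳ (F 0)) ⟩
    F 0 + 0  ≡⟨ *-cancelˡ-≡ (F 0 + 0) (0 + F 1) n {{>-nonZero (odd⇒1≤n {n} n-odd)}} (trans evens (sym odds)) ⟩
    0 + F 1  ≡⟨⟩
    F 1      ∎
    where
    pick : ∀ x → when (even (toℕ x)) (F (toℕ x)) ≡ when (even (toℕ x)) (F 0)
               × when (not (even (toℕ x))) (F (toℕ x)) ≡ when (not (even (toℕ x))) (F 1)
    pick x = when-if (even (toℕ x)) (alt (toℕ x) (toℕ<n x))
    evens : n * (F 0 + 0) ≡ ∑[ i < 3 * n ] label {n} f i
    evens = begin
      n * (F 0 + 0)                                 ≡⟨ sym (∑-parity n (λ β → when β (F 0))) ⟩
      ∑[ x < 2 * n ] when (even (toℕ x)) (F 0)       ≡⟨ sym (sum-cong-≗ {2 * n} (λ x → proj₁ (pick x))) ⟩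
      ∑[ x < 2 * n ] when (even (toℕ x)) (F (toℕ x)) ≡⟨ class-sum even (λ _ _ e → e) ⟩
      ∑[ i < 3 * n ] label {n} f i                  ∎
    odds : n * (0 + F 1) ≡ ∑[ i < 3 * n ] label {n} f i
    odds = begin
      n * (0 + F 1)                                       ≡⟨ sym (∑-parity n (λ β → when (not β) (F 1))) ⟩
      ∑[ x < 2 * n ] when (not (even (toℕ x))) (F 1)       ≡⟨ sym (sum-cong-≗ {2 * n} (λ x → proj₂ (pick x))) ⟩
      ∑[ x < 2 * n ] when (not (even (toℕ x))) (F (toℕ x)) ≡⟨ class-sum (λ y → not (even y)) (λ _ _ e → cong not e) ⟩
      ∑[ i < 3 * n ] label {n} f i                        ∎

  lower-bound : 3 ≤ colours n f
  lower-bound = ≮⇒≥ (λ few → adjacent 0 1<2n (F0≡F1 (alternating (two-values few))))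

record Perm (m : ℕ) : Set where
  field
    to from : ℕ → ℕ
    to<     : ∀ {x} → x < m → to x < m
    from<   : ∀ {x} → x < m → from x < m
    from-to : ∀ {x} → x < m → from (to x) ≡ x
    to-from : ∀ {x} → x < m → to (from x) ≡ x
open Perm

toLabeling : ∀ {n} → Perm (3 * n) → Labeling n
toLabeling {n} π = ↔⇒⤖ (mk↔ₛ′ to′ from′ to∘from from∘to)
  where
  to′ from′ : Fin (3 * n) → Fin (3 * n)
  to′   i = fromℕ< (to< π (toℕ<n i))
  from′ i = fromℕ< (from< π (toℕ<n i))
  to∘from : ∀ i → to′ (from′ i) ≡ i
  to∘from i = toℕ-injective (begin
    toℕ (to′ (from′ i))        ≡⟨ toℕ-fromℕ< _ ⟩
    to π (toℕ (from′ i))       ≡⟨ cong (to π) (toℕ-fromℕ< _) ⟩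
    to π (from π (toℕ i))      ≡⟨ to-from π (toℕ<n i) ⟩
    toℕ i                      ∎)
  from∘to : ∀ i → from′ (to′ i) ≡ i
  from∘to i = toℕ-injective (begin
    toℕ (from′ (to′ i))        ≡⟨ toℕ-fromℕ< _ ⟩
    from π (toℕ (to′ i))       ≡⟨ cong (from π) (toℕ-fromℕ< _) ⟩
    from π (to π (toℕ i))      ≡⟨ from-to π (toℕ<n i) ⟩
    toℕ i                      ∎)

label-toLabeling : ∀ {n} (π : Perm (3 * n)) i → label {n} (toLabeling {n} π) i ≡ suc (to π (toℕ i))
label-toLabeling π i = cong suc (toℕ-fromℕ< (to< π (toℕ<n i)))

ladder-to : ℕ → (α β γ : ℕ → ℕ) → ℕ → ℕ
ladder-to n α β γ j =
  if ⌊ j <? 2 * n ⌋ then (if even j then n + β ⌊ j /2⌋ else α ⌊ j /2⌋) else 2 * n + γ (j ∸ 2 * n)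

ladder-from : ℕ → (α β γ : ℕ → ℕ) → ℕ → ℕ
ladder-from n α β γ v =
  if ⌊ v <? n ⌋ then suc (2 * α v) else (if ⌊ v <? 2 * n ⌋ then 2 * β (v ∸ n) else 2 * n + γ (v ∸ 2 * n))

module _ (n : ℕ) (α β γ : ℕ → ℕ) where

  ladder-odd : ∀ t → suc (2 * t) < 2 * n → ladder-to n α β γ (suc (2 * t)) ≡ α t
  ladder-odd t p = trans (if-yes (suc (2 * t) <? 2 * n) p)
                         (trans (if-false (even-1+2* t)) (cong α (⌊1+2*t/2⌋ t)))

  ladder-even : ∀ t → 2 * t < 2 * n → ladder-to n α β γ (2 * t) ≡ n + β t
  ladder-even t p = trans (if-yes (2 * t <? 2 * n) p)
                          (trans (if-true (even-2* t)) (cong (λ s → n + β s) (⌊2*t/2⌋ t)))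

  ladder-rung : ∀ x → ladder-to n α β γ (2 * n + x) ≡ 2 * n + γ x
  ladder-rung x = trans (if-no (2 * n + x <? 2 * n) (m+n≮m (2 * n) x)) (cong (λ y → 2 * n + γ y) (m+n∸m≡n (2 * n) x))

  ladder-from-low : ∀ {v} → v < n → ladder-from n α β γ v ≡ suc (2 * α v)
  ladder-from-low {v} v<n = if-yes (v <? n) v<n

  ladder-from-mid : ∀ {s} → s < n → ladder-from n α β γ (n + s) ≡ 2 * β s
  ladder-from-mid {s} s<n =
    trans (if-no (n + s <? n) (m+n≮m n s))
          (trans (if-yes (n + s <? 2 * n) (subst (n + s <_) (sym (2n≡n+n n)) (+-monoʳ-< n s<n)))
                 (cong (λ y → 2 * β y) (m+n∸m≡n n s)))

  ladder-from-high : ∀ y → ladder-from n α β γ (2 * n + y) ≡ 2 * n + γ y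
  ladder-from-high y =
    trans (if-no (2 * n + y <? n) (≤⇒≯ (≤-trans (m≤n*m n 2) (m≤m+n (2 * n) y))))
          (trans (if-no (2 * n + y <? 2 * n) (m+n≮m (2 * n) y))
                 (cong (λ z → 2 * n + γ z) (m+n∸m≡n (2 * n) y)))

module _ (n : ℕ) (α β γ : Perm n) where
  private
    L L⁻ : ℕ → ℕ
    L  = ladder-to n (to α) (to β) (to γ)
    L⁻ = ladder-from n (from α) (from β) (from γ)
    odd′  : ∀ t → suc (2 * t) < 2 * n → L (suc (2 * t)) ≡ to α t
    odd′  = ladder-odd  n (to α) (to β) (to γ)
    even′ : ∀ t → 2 * t < 2 * n → L (2 * t) ≡ n + to β t
    even′ = ladder-even n (to α) (to β) (to γ)
    rung′ : ∀ x → L (2 * n + x) ≡ 2 * n + to γ x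
    rung′ = ladder-rung n (to α) (to β) (to γ)
    low′  : ∀ {v} → v < n → L⁻ v ≡ suc (2 * from α v)
    low′  = ladder-from-low  n (from α) (from β) (from γ)
    mid′  : ∀ {s} → s < n → L⁻ (n + s) ≡ 2 * from β s
    mid′  = ladder-from-mid  n (from α) (from β) (from γ)
    high′ : ∀ y → L⁻ (2 * n + y) ≡ 2 * n + from γ y
    high′ = ladder-from-high n (from α) (from β) (from γ)

  ladder-forward : ∀ {j} → j < 3 * n → L j < 3 * n × L⁻ (L j) ≡ j
  ladder-forward {j} j<3n with split (2 * n) n j (subst (j <_) (3n≡2n+n n) j<3n)
  ... | high x x<n =
    subst (_< 3 * n) (sym (rung′ x)) (high<3n (to< γ x<n)) ,
    (begin
      L⁻ (L (2 * n + x))        ≡⟨ cong L⁻ (rung′ x) ⟩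
      L⁻ (2 * n + to γ x)       ≡⟨ high′ (to γ x) ⟩
      2 * n + from γ (to γ x)   ≡⟨ cong (2 * n +_) (from-to γ x<n) ⟩
      2 * n + x                 ∎)
  ... | low j<2n with evenOdd j
  ...   | even-form t =
    subst (_< 3 * n) (sym (even′ t j<2n)) (mid<3n (to< β t<n)) ,
    (begin
      L⁻ (L (2 * t))            ≡⟨ cong L⁻ (even′ t j<2n) ⟩
      L⁻ (n + to β t)           ≡⟨ mid′ (to< β t<n) ⟩
      2 * from β (to β t)       ≡⟨ cong (2 *_) (from-to β t<n) ⟩
      2 * t                     ∎)
    where
    t<n : t < n
    t<n = half-< j<2n
  ...   | odd-form t =
    subst (_< 3 * n) (sym (odd′ t j<2n)) (<2n⇒<3n n (<-≤-trans (to< α t<n) (m≤m+n n (n + 0)))) ,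
    (begin
      L⁻ (L (suc (2 * t)))      ≡⟨ cong L⁻ (odd′ t j<2n) ⟩
      L⁻ (to α t)               ≡⟨ low′ (to< α t<n) ⟩
      suc (2 * from α (to α t)) ≡⟨ cong (λ y → suc (2 * y)) (from-to α t<n) ⟩
      suc (2 * t)               ∎)
    where
    t<n : t < n
    t<n = half-< (<-trans (n<1+n _) j<2n)

  ladder-backward : ∀ {v} → v < 3 * n → L⁻ v < 3 * n × L (L⁻ v) ≡ v
  ladder-backward {v} v<3n with split (2 * n) n v (subst (v <_) (3n≡2n+n n) v<3n)
  ... | high y y<n =
    subst (_< 3 * n) (sym (high′ y)) (high<3n (from< γ y<n)) ,
    (begin
      L (L⁻ (2 * n + y))        ≡⟨ cong L (high′ y) ⟩
      L (2 * n + from γ y)      ≡⟨ rung′ (from γ y) ⟩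
      2 * n + to γ (from γ y)   ≡⟨ cong (2 * n +_) (to-from γ y<n) ⟩
      2 * n + y                 ∎)
  ... | low v<2n with split n n v (subst (v <_) (2n≡n+n n) v<2n)
  ...   | low v<n =
    subst (_< 3 * n) (sym (low′ v<n)) (<2n⇒<3n n (1+2*<2* (from< α v<n))) ,
    (begin
      L (L⁻ v)                  ≡⟨ cong L (low′ v<n) ⟩
      L (suc (2 * from α v))    ≡⟨ odd′ (from α v) (1+2*<2* (from< α v<n)) ⟩
      to α (from α v)           ≡⟨ to-from α v<n ⟩
      v                         ∎)
  ...   | high s s<n =
    subst (_< 3 * n) (sym (mid′ s<n)) (<2n⇒<3n n (*-monoʳ-< 2 (from< β s<n))) ,
    (begin
      L (L⁻ (n + s))            ≡⟨ cong L (mid′ s<n) ⟩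
      L (2 * from β s)          ≡⟨ even′ (from β s) (*-monoʳ-< 2 (from< β s<n)) ⟩
      n + to β (from β s)       ≡⟨ cong (n +_) (to-from β s<n) ⟩
      n + s                     ∎)

ladderPerm : ∀ n → Perm n → Perm n → Perm n → Perm (3 * n)
ladderPerm n α β γ = record
  { to      = ladder-to n (to α) (to β) (to γ)
  ; from    = ladder-from n (from α) (from β) (from γ)
  ; to<     = λ j<3n → proj₁ (ladder-forward n α β γ j<3n)
  ; from<   = λ v<3n → proj₁ (ladder-backward n α β γ v<3n)
  ; from-to = λ j<3n → proj₂ (ladder-forward n α β γ j<3n)
  ; to-from = λ v<3n → proj₂ (ladder-backward n α β γ v<3n)
  }

idPerm : ∀ m → Perm m
idPerm m = record
  { to = λ x → x ; from = λ x → x ; to< = λ x<m → x<m ; from< = λ x<m → x<m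
  ; from-to = λ _ → refl ; to-from = λ _ → refl }

-- τ sends 0, …, k-1 to the odd numbers 2k-1, …, 1 and k, …, 2k to the even numbers
-- 2k, …, 0: τ t = 2k - 1 - 2t for t < k and τ t = 4k - 2t for k ≤ t ≤ 2k.
τ-to : ℕ → ℕ → ℕ
τ-to k t = if ⌊ t <? k ⌋ then 2 * k ∸ suc (2 * t) else 4 * k ∸ 2 * t

τ-from : ℕ → ℕ → ℕ
τ-from k s = if even s then 2 * k ∸ ⌊ s /2⌋ else k ∸ suc ⌊ s /2⌋

τ-below : ∀ k t s → suc (t + s) ≡ k → τ-to k t ≡ suc (2 * s)
τ-below _ t s refl =
  trans (if-yes (t <? suc (t + s)) (s≤s (m≤m+n t s))) (∸-by (2 * suc (t + s)) (suc (2 * t)) (solve (t ∷ s ∷ [])))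

τ-above : ∀ k t a b → k + a ≡ t → a + b ≡ k → τ-to k t ≡ 2 * b
τ-above _ _ a b refl refl =
  trans (if-no ((a + b) + a <? a + b) (m+n≮m (a + b) a)) (∸-by (4 * (a + b)) (2 * ((a + b) + a)) (solve (a ∷ b ∷ [])))

τ-from-odd : ∀ k w c → suc (w + c) ≡ k → τ-from k (suc (2 * w)) ≡ c
τ-from-odd _ w c refl =
  trans (if-false (even-1+2* w)) (trans (cong (λ h → suc (w + c) ∸ suc h) (⌊1+2*t/2⌋ w)) (m+n∸m≡n w c))

τ-from-even : ∀ k w b → w + b ≡ k → τ-from k (2 * w) ≡ w + 2 * b
τ-from-even _ w b refl =
  trans (if-true (even-2* w)) (trans (cong (2 * (w + b) ∸_) (⌊2*t/2⌋ w)) (∸-by (2 * (w + b)) w (solve (w ∷ b ∷ []))))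

τ-forward : ∀ k {t} → t < suc (2 * k) → τ-to k t < suc (2 * k) × τ-from k (τ-to k t) ≡ t
τ-forward k {t} t<n with below-or-above t k
... | inj₁ (s , refl) =
  subst (_< suc (2 * k)) (sym τt≡) bound , trans (cong (τ-from k) τt≡) (τ-from-odd k s t (cong suc (+-comm s t)))
  where
  τt≡ : τ-to k t ≡ suc (2 * s)
  τt≡ = τ-below k t s refl
  bound : suc (2 * s) < suc (2 * suc (t + s))
  bound = s≤s (*-monoʳ-< 2 (s≤s (m≤n+m s t)))
... | inj₂ (a , refl) with m≤n⇒∃[o]m+o≡n (above⇒≤ {k} {a} t<n)
...   | b , refl =
  subst (_< suc (2 * k)) (sym τt≡) bound , trans (cong (τ-from k) τt≡) (trans (τ-from-even k b a (+-comm b a)) back)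
  where
  τt≡ : τ-to (a + b) ((a + b) + a) ≡ 2 * b
  τt≡ = τ-above k t a b refl refl
  bound : 2 * b < suc (2 * (a + b))
  bound = s≤s (*-monoʳ-≤ 2 (m≤n+m b a))
  back : b + 2 * a ≡ (a + b) + a
  back = solve (a ∷ b ∷ [])

τ-backward : ∀ k {s} → s < suc (2 * k) → τ-from k s < suc (2 * k) × τ-to k (τ-from k s) ≡ s
τ-backward k {s} s<n with evenOdd s
... | odd-form w with m≤n⇒∃[o]m+o≡n (half-< {w} {k} (≤-pred s<n))
...   | c , refl =
  subst (_< suc (2 * k)) (sym τ⁻s≡) bound , trans (cong (τ-to k) τ⁻s≡) (τ-below k c w (cong suc (+-comm c w)))
  where
  τ⁻s≡ : τ-from (suc (w + c)) (suc (2 * w)) ≡ c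
  τ⁻s≡ = τ-from-odd k w c refl
  bound : c < suc (2 * suc (w + c))
  bound = ≤⇒<1+2* (m≤n⇒m≤1+n (m≤n+m c w))
τ-backward k {s} s<n | even-form w with m≤n⇒∃[o]m+o≡n (*-cancelˡ-≤ {w} {k} 2 (≤-pred s<n))
...   | b , refl =
  subst (_< suc (2 * k)) (sym τ⁻s≡) bound , trans (cong (τ-to k) τ⁻s≡) (τ-above k (w + 2 * b) b w above (+-comm b w))
  where
  τ⁻s≡ : τ-from (w + b) (2 * w) ≡ w + 2 * b
  τ⁻s≡ = τ-from-even k w b refl
  rearrange : w + 2 * b + w ≡ 2 * (w + b)
  rearrange = solve (w ∷ b ∷ [])
  bound : w + 2 * b < suc (2 * (w + b))
  bound = s≤s (≤-by w rearrange)
  above : (w + b) + b ≡ w + 2 * b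
  above = solve (w ∷ b ∷ [])

τPerm : ∀ k → Perm (suc (2 * k))
τPerm k = record
  { to = τ-to k ; from = τ-from k
  ; to< = λ t<n → proj₁ (τ-forward k t<n) ; from< = λ s<n → proj₁ (τ-backward k s<n)
  ; from-to = λ t<n → proj₂ (τ-forward k t<n) ; to-from = λ s<n → proj₂ (τ-backward k s<n) }

-- ρ sends the even numbers 2m ≤ 2k to m and the odd numbers 2m + 1 < 2k to k + 1 + m.
ρ-to : ℕ → ℕ → ℕ
ρ-to k x = if even x then ⌊ x /2⌋ else suc (k + ⌊ x /2⌋)

ρ-from : ℕ → ℕ → ℕ
ρ-from k y = if ⌊ y <? suc k ⌋ then 2 * y else suc (2 * (y ∸ suc k))

ρ-even : ∀ k m → ρ-to k (2 * m) ≡ m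
ρ-even k m = trans (if-true (even-2* m)) (⌊2*t/2⌋ m)

ρ-odd : ∀ k m → ρ-to k (suc (2 * m)) ≡ suc (k + m)
ρ-odd k m = trans (if-false (even-1+2* m)) (cong (λ h → suc (k + h)) (⌊1+2*t/2⌋ m))

ρ-from-low : ∀ k {y} → y ≤ k → ρ-from k y ≡ 2 * y
ρ-from-low k {y} y≤k = if-yes (y <? suc k) (s≤s y≤k)

ρ-from-high : ∀ k m → ρ-from k (suc (k + m)) ≡ suc (2 * m)
ρ-from-high k m = trans (if-no (suc (k + m) <? suc k) (m+n≮m (suc k) m)) (cong (λ h → suc (2 * h)) (m+n∸m≡n k m))

ρ-forward : ∀ k {x} → x < suc (2 * k) → ρ-to k x < suc (2 * k) × ρ-from k (ρ-to k x) ≡ x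
ρ-forward k {x} x<n with evenOdd x
... | even-form m =
  subst (_< suc (2 * k)) (sym (ρ-even k m)) (≤⇒<1+2* m≤k) ,
  trans (cong (ρ-from k) (ρ-even k m)) (ρ-from-low k m≤k)
  where
  m≤k : m ≤ k
  m≤k = *-cancelˡ-≤ {m} {k} 2 (≤-pred x<n)
... | odd-form m =
  subst (_< suc (2 * k)) (sym (ρ-odd k m)) (s≤s (subst (k + m <_) (sym (2n≡n+n k)) (+-monoʳ-< k m<k))) ,
  trans (cong (ρ-from k) (ρ-odd k m)) (ρ-from-high k m)
  where
  m<k : m < k
  m<k = half-< {m} {k} (≤-pred x<n)

ρ-backward : ∀ k {y} → y < suc (2 * k) → ρ-from k y < suc (2 * k) × ρ-to k (ρ-from k y) ≡ y
ρ-backward k {y} y<n with y ≤? k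
... | yes y≤k =
  subst (_< suc (2 * k)) (sym (ρ-from-low k y≤k)) (s≤s (*-monoʳ-≤ 2 y≤k)) ,
  trans (cong (ρ-to k) (ρ-from-low k y≤k)) (ρ-even k y)
... | no y≰k with m≤n⇒∃[o]m+o≡n (≰⇒> y≰k)
...   | m , refl =
  subst (_< suc (2 * k)) (sym (ρ-from-high k m)) (s≤s (*-monoʳ-< 2 m<k)) ,
  trans (cong (ρ-to k) (ρ-from-high k m)) (ρ-odd k m)
  where
  m<k : m < k
  m<k = +-cancelˡ-< k m k (subst (k + m <_) (2n≡n+n k) (≤-pred y<n))

ρPerm : ∀ k → Perm (suc (2 * k))
ρPerm k = record
  { to = ρ-to k ; from = ρ-from k
  ; to< = λ x<n → proj₁ (ρ-forward k x<n) ; from< = λ y<n → proj₁ (ρ-backward k y<n)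
  ; from-to = λ x<n → proj₂ (ρ-forward k x<n) ; to-from = λ y<n → proj₂ (ρ-backward k y<n) }

-- The labeling of M_{2n}, n = 2k + 1: odd cycle edges 2t+1 get label t + 1, even cycle
-- edges 2t get n + 1 + τ t and the rungs 2n + x get 2n + 1 + ρ x; edge j gets 1 + L k j.
L : ℕ → ℕ → ℕ
L k = ladder-to (suc (2 * k)) (λ x → x) (τ-to k) (ρ-to k)

ladder : ∀ k → Perm (3 * suc (2 * k))
ladder k = ladderPerm (suc (2 * k)) (idPerm (suc (2 * k))) (τPerm k) (ρPerm k)

-- Only the labels of the construction matter below, so its bijection is kept opaque.
opaque
  labeling : ∀ k → Labeling (suc (2 * k))
  labeling k = toLabeling {suc (2 * k)} (ladder k)

  label-labeling : ∀ k i → label {suc (2 * k)} (labeling k) i ≡ suc (L k (toℕ i))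
  label-labeling k = label-toLabeling {suc (2 * k)} (ladder k)

F : ℕ → ℕ → ℕ
F k = fplus (suc (2 * k)) (labeling k)

F≡ : ∀ k x → x < 2 * suc (2 * k) →
     F k x ≡ suc (L k x) + (suc (L k (prev (suc (2 * k)) x)) + suc (L k (2 * suc (2 * k) + rung (suc (2 * k)) x)))
F≡ k = vertex-sum (suc (2 * k)) (labeling k) (λ j → suc (L k j)) (label-labeling k)

prev-label : ∀ k t → 1 ≤ t → 2 * t < 2 * suc (2 * k) → suc (L k (prev (suc (2 * k)) (2 * t))) ≡ t
prev-label k (suc u) _ x<2n = cong suc (begin
  L k (prev (suc (2 * k)) (2 * suc u))   ≡⟨ cong (λ y → L k (prev (suc (2 * k)) y)) (*-suc 2 u) ⟩
  L k (suc (2 * u))                      ≡⟨ ladder-odd (suc (2 * k)) (λ x → x) (τ-to k) (ρ-to k) u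
                                                       (<-trans (n<1+n _) (subst (_< 2 * suc (2 * k)) (*-suc 2 u) x<2n)) ⟩
  u                                      ∎)

prev-label-zero : ∀ k → suc (L k (prev (suc (2 * k)) 0)) ≡ suc (2 * k)
prev-label-zero k = cong suc (begin
  L k (2 * suc (2 * k) ∸ 1)  ≡⟨ cong (L k) (∸-by (2 * suc (2 * k)) 1 {suc (2 * (2 * k))} (trans (+-comm (suc (2 * (2 * k))) 1) last)) ⟩
  L k (suc (2 * (2 * k)))    ≡⟨ ladder-odd (suc (2 * k)) (λ x → x) (τ-to k) (ρ-to k) (2 * k) (≤-reflexive last) ⟩
  2 * k                      ∎)
  where
  last : suc (suc (2 * (2 * k))) ≡ 2 * suc (2 * k)
  last = solve (k ∷ [])

ρ-rung-even : ∀ k t → 2 * t < 2 * suc (2 * k) → ρ-to k (rung (suc (2 * k)) (2 * t)) ≡ t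
ρ-rung-even k t x<2n with t ≤? k
... | yes t≤k = trans (cong (ρ-to k) (rung-low (s≤s (*-monoʳ-≤ 2 t≤k)))) (ρ-even k t)
... | no t≰k with m≤n⇒∃[o]m+o≡n (≰⇒> t≰k)
...   | m , refl = begin
  ρ-to k (rung (suc (2 * k)) (2 * suc (k + m)))             ≡⟨ cong (λ y → ρ-to k (rung (suc (2 * k)) y)) shift ⟩
  ρ-to k (rung (suc (2 * k)) (suc (2 * k) + suc (2 * m)))   ≡⟨ cong (ρ-to k) (rung-high (suc (2 * k)) (suc (2 * m))) ⟩
  ρ-to k (suc (2 * m))                                      ≡⟨ ρ-odd k m ⟩
  suc (k + m)                                               ∎
  where
  shift : 2 * suc (k + m) ≡ suc (2 * k) + suc (2 * m)
  shift = solve (k ∷ m ∷ [])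

odd-sum : ∀ k t → suc (2 * t) < 2 * suc (2 * k) →
  F k (suc (2 * t)) ≡ suc t + (suc (suc (2 * k) + τ-to k t) + suc (2 * suc (2 * k) + ρ-to k (rung (suc (2 * k)) (suc (2 * t)))))
odd-sum k t x<2n = trans (F≡ k _ x<2n)
  (cong₂ (λ u v → suc u + v) (ladder-odd n (λ x → x) (τ-to k) (ρ-to k) t x<2n)
         (cong₂ (λ u v → suc u + suc v) (ladder-even n (λ x → x) (τ-to k) (ρ-to k) t (<-trans (n<1+n _) x<2n))
                                        (ladder-rung n (λ x → x) (τ-to k) (ρ-to k) _)))
  where
  n : ℕ
  n = suc (2 * k)

even-sum : ∀ k t → 2 * t < 2 * suc (2 * k) →
  F k (2 * t) ≡ suc (suc (2 * k) + τ-to k t) + (suc (L k (prev (suc (2 * k)) (2 * t))) + suc (2 * suc (2 * k) + t))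
even-sum k t x<2n = trans (F≡ k _ x<2n)
  (cong₂ (λ u v → suc u + (suc (L k (prev n (2 * t))) + suc v))
         (ladder-even n (λ x → x) (τ-to k) (ρ-to k) t x<2n)
         (trans (ladder-rung n (λ x → x) (τ-to k) (ρ-to k) _) (cong (2 * n +_) (ρ-rung-even k t x<2n))))
  where
  n : ℕ
  n = suc (2 * k)

F-odd : ∀ k t → suc (2 * t) < 2 * suc (2 * k) → F k (suc (2 * t)) ≡ 9 * k + 6
F-odd k t x<2n with below-or-above t k
... | inj₁ (s , refl) = begin
  F k (suc (2 * t))
    ≡⟨ odd-sum k t x<2n ⟩
  suc t + (suc (suc (2 * k) + τ-to k t) + suc (2 * suc (2 * k) + ρ-to k (rung (suc (2 * k)) (suc (2 * t)))))
    ≡⟨ cong₂ (λ u v → suc t + (suc (suc (2 * k) + u) + suc (2 * suc (2 * k) + v))) (τ-below k t s refl) ρ-rung ⟩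
  suc t + (suc (suc (2 * k) + suc (2 * s)) + suc (2 * suc (2 * k) + suc (k + t)))
    ≡⟨ solve (t ∷ s ∷ []) ⟩
  9 * k + 6 ∎
  where
  ρ-rung : ρ-to k (rung (suc (2 * k)) (suc (2 * t))) ≡ suc (k + t)
  ρ-rung = trans (cong (ρ-to k) (rung-low (s≤s (*-monoʳ-< 2 (s≤s (m≤m+n t s)))))) (ρ-odd k t)
... | inj₂ (a , refl) with m≤n⇒∃[o]m+o≡n (above⇒≤ {k} {a} (half-< (<-trans (n<1+n _) x<2n)))
...   | b , refl = begin
  F k (suc (2 * t))
    ≡⟨ odd-sum k t x<2n ⟩
  suc t + (suc (suc (2 * k) + τ-to k t) + suc (2 * suc (2 * k) + ρ-to k (rung (suc (2 * k)) (suc (2 * t)))))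
    ≡⟨ cong₂ (λ u v → suc t + (suc (suc (2 * k) + u) + suc (2 * suc (2 * k) + v))) (τ-above k t a b refl refl) ρ-rung ⟩
  suc t + (suc (suc (2 * k) + 2 * b) + suc (2 * suc (2 * k) + a))
    ≡⟨ solve (a ∷ b ∷ []) ⟩
  9 * k + 6 ∎
  where
  shift : suc (2 * t) ≡ suc (2 * k) + 2 * a
  shift = solve (a ∷ b ∷ [])
  ρ-rung : ρ-to k (rung (suc (2 * k)) (suc (2 * t))) ≡ a
  ρ-rung = trans (cong (λ y → ρ-to k (rung (suc (2 * k)) y)) shift)
                 (trans (cong (ρ-to k) (rung-high (suc (2 * k)) (2 * a))) (ρ-even k a))

even-below : ∀ t s → 2 * t < 2 * suc (2 * suc (t + s)) →
  F (suc (t + s)) (2 * t) ≡ 8 * suc (t + s) + 4 ⊎ F (suc (t + s)) (2 * t) ≡ 10 * suc (t + s) + 5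
even-below zero s x<2n = inj₂ (begin
  F (suc s) 0
    ≡⟨ even-sum (suc s) 0 x<2n ⟩
  suc (suc (2 * suc s) + τ-to (suc s) 0) + (suc (L (suc s) (prev (suc (2 * suc s)) 0)) + suc (2 * suc (2 * suc s) + 0))
    ≡⟨ cong₂ (λ u v → suc (suc (2 * suc s) + u) + (v + suc (2 * suc (2 * suc s) + 0)))
             (τ-below (suc s) 0 s refl) (prev-label-zero (suc s)) ⟩
  suc (suc (2 * suc s) + suc (2 * s)) + (suc (2 * suc s) + suc (2 * suc (2 * suc s) + 0))
    ≡⟨ solve (s ∷ []) ⟩
  10 * suc s + 5 ∎)
even-below (suc u) s x<2n = inj₁ (begin
  F k (2 * suc u)
    ≡⟨ even-sum k (suc u) x<2n ⟩
  suc (suc (2 * k) + τ-to k (suc u)) + (suc (L k (prev (suc (2 * k)) (2 * suc u))) + suc (2 * suc (2 * k) + suc u))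
    ≡⟨ cong₂ (λ x y → suc (suc (2 * k) + x) + (y + suc (2 * suc (2 * k) + suc u)))
             (τ-below k (suc u) s refl) (prev-label k (suc u) (s≤s z≤n) x<2n) ⟩
  suc (suc (2 * suc (suc u + s)) + suc (2 * s)) + (suc u + suc (2 * suc (2 * suc (suc u + s)) + suc u))
    ≡⟨ solve (u ∷ s ∷ []) ⟩
  8 * suc (suc u + s) + 4 ∎)
  where
  k : ℕ
  k = suc (suc u + s)

F-even : ∀ k → 1 ≤ k → ∀ t → 2 * t < 2 * suc (2 * k) → F k (2 * t) ≡ 8 * k + 4 ⊎ F k (2 * t) ≡ 10 * k + 5
F-even k 1≤k t x<2n with below-or-above t k
... | inj₁ (s , refl) = even-below t s x<2n
... | inj₂ (a , refl) with m≤n⇒∃[o]m+o≡n (above⇒≤ {k} {a} (half-< x<2n))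
...   | b , refl = inj₂ (begin
  F k (2 * t)
    ≡⟨ even-sum k t x<2n ⟩
  suc (suc (2 * k) + τ-to k t) + (suc (L k (prev (suc (2 * k)) (2 * t))) + suc (2 * suc (2 * k) + t))
    ≡⟨ cong₂ (λ x y → suc (suc (2 * k) + x) + (y + suc (2 * suc (2 * k) + t)))
             (τ-above k t a b refl refl) (prev-label k t (≤-trans 1≤k (m≤m+n k a)) x<2n) ⟩
  suc (suc (2 * k) + 2 * b) + (t + suc (2 * suc (2 * k) + t))
    ≡⟨ solve (a ∷ b ∷ []) ⟩
  10 * k + 5 ∎)

vertex-class : ∀ k → 1 ≤ k → ∀ x → x < 2 * suc (2 * k) →
  (even x ≡ false × F k x ≡ 9 * k + 6) ⊎ (even x ≡ true × (F k x ≡ 8 * k + 4 ⊎ F k x ≡ 10 * k + 5))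
vertex-class k 1≤k x x<2n with evenOdd x
... | even-form t = inj₂ (even-2* t , F-even k 1≤k t x<2n)
... | odd-form t  = inj₁ (even-1+2* t , F-odd k t x<2n)

odd≢even : ∀ k → 2 ≤ k → ∀ {v} → v ≡ 8 * k + 4 ⊎ v ≡ 10 * k + 5 → 9 * k + 6 ≢ v
odd≢even k _ (inj₁ refl) = >⇒≢ (≤-by (suc k) below)
  where
  below : suc (8 * k + 4) + suc k ≡ 9 * k + 6
  below = solve (k ∷ [])
odd≢even (suc zero) (s≤s ()) (inj₂ refl)
odd≢even (suc (suc u)) _ (inj₂ refl) = <⇒≢ (≤-by u above)
  where
  above : suc (9 * suc (suc u) + 6) + u ≡ 10 * suc (suc u) + 5
  above = solve (u ∷ [])

-- For k ≥ 2 the construction is local antimagic: every edge joins an odd and an even vertex.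
antimagic : ∀ k → 2 ≤ k → IsLocalAntimagic (suc (2 * k)) (labeling k)
antimagic k 2≤k i with edge-parity (suc (2 * k)) (even-1+2* k) (toℕ i) (toℕ<n i)
... | p<2n , q<2n , parity with vertex-class k 1≤k _ p<2n | vertex-class k 1≤k _ q<2n
  where
  1≤k : 1 ≤ k
  1≤k = ≤-trans (s≤s z≤n) 2≤k
...   | inj₁ (_ , Fp) | inj₂ (_ , Fq) = λ Fp≡Fq → odd≢even k 2≤k Fq (trans (sym Fp) Fp≡Fq)
...   | inj₂ (_ , Fp) | inj₁ (_ , Fq) = λ Fp≡Fq → odd≢even k 2≤k Fp (trans (sym Fq) (sym Fp≡Fq))
...   | inj₁ (ep , _) | inj₁ (eq , _) = contradiction (trans (sym ep) (trans parity (cong not eq))) λ ()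
...   | inj₂ (ep , _) | inj₂ (eq , _) = contradiction (trans (sym ep) (trans parity (cong not eq))) λ ()

colours≤3 : ∀ k → 1 ≤ k → colours (suc (2 * k)) (labeling k) ≤ 3
colours≤3 k 1≤k = unique⊆⇒length≤ (deduplicate-! _≟_ sums) values⊆
  where
  sums : List ℕ
  sums = map (F k) (upTo (2 * suc (2 * k)))
  values⊆ : deduplicate _≟_ sums ⊆ (9 * k + 6 ∷ 8 * k + 4 ∷ 10 * k + 5 ∷ [])
  values⊆ {z} z∈values with ∈-map⁻ (F k) {xs = upTo (2 * suc (2 * k))} (∈-deduplicate⁻ _≟_ sums z∈values)
  ... | x , x∈ , refl with vertex-class k 1≤k x (∈-upTo⁻ x∈)
  ...   | inj₁ (_ , Fx)      = here Fx
  ...   | inj₂ (_ , inj₁ Fx) = there (here Fx)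
  ...   | inj₂ (_ , inj₂ Fx) = there (there (here Fx))

-- n = 3: the general pattern fails (9k + 6 = 10k + 5 for k = 1); an explicit labeling
-- with labels 3 4 2 6 9 1 7 8 5 on the edges 0, …, 8 has three colours.
module Three where
  labels inverse : Fin 9 → Fin 9
  labels 0F = 2F ; labels 1F = 3F ; labels 2F = 1F ; labels 3F = 5F ; labels 4F = 8F
  labels 5F = 0F ; labels 6F = 6F ; labels 7F = 7F ; labels 8F = 4F
  inverse 0F = 5F ; inverse 1F = 2F ; inverse 2F = 0F ; inverse 3F = 1F ; inverse 4F = 8F
  inverse 5F = 3F ; inverse 6F = 6F ; inverse 7F = 7F ; inverse 8F = 4F

  labels∘inverse : ∀ y → labels (inverse y) ≡ y
  labels∘inverse 0F = refl ; labels∘inverse 1F = refl ; labels∘inverse 2F = refl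
  labels∘inverse 3F = refl ; labels∘inverse 4F = refl ; labels∘inverse 5F = refl
  labels∘inverse 6F = refl ; labels∘inverse 7F = refl ; labels∘inverse 8F = refl

  inverse∘labels : ∀ x → inverse (labels x) ≡ x
  inverse∘labels 0F = refl ; inverse∘labels 1F = refl ; inverse∘labels 2F = refl
  inverse∘labels 3F = refl ; inverse∘labels 4F = refl ; inverse∘labels 5F = refl
  inverse∘labels 6F = refl ; inverse∘labels 7F = refl ; inverse∘labels 8F = refl

  labeling₃ : Labeling 3
  labeling₃ = ↔⇒⤖ (mk↔ₛ′ labels inverse labels∘inverse inverse∘labels)

  antimagic₃ : IsLocalAntimagic 3 labeling₃
  antimagic₃ 0F () ; antimagic₃ 1F () ; antimagic₃ 2F () ; antimagic₃ 3F () ; antimagic₃ 4F ()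
  antimagic₃ 5F () ; antimagic₃ 6F () ; antimagic₃ 7F () ; antimagic₃ 8F ()

  colours₃ : colours 3 labeling₃ ≡ 3
  colours₃ = refl

lower-bound : ∀ k (f : Labeling (suc (2 * k))) → IsLocalAntimagic (suc (2 * k)) f → 3 ≤ colours (suc (2 * k)) f
lower-bound k f anti = LowerBound.lower-bound (suc (2 * k)) (even-1+2* k) f anti

χ≡3 : ∀ k (f : Labeling (suc (2 * k))) → IsLocalAntimagic (suc (2 * k)) f → colours (suc (2 * k)) f ≤ 3 →
      ChiLaMobiusIs (suc (2 * k)) 3
χ≡3 k f anti few = (f , anti , ≤-antisym few (lower-bound k f anti)) , lower-bound k

mainTheorem9 : (n : ℕ) → 3 ≤ n → Σ ℕ (λ k → n ≡ suc (2 * k)) → ChiLaMobiusIs n 3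
mainTheorem9 _ (s≤s ()) (zero , refl)
mainTheorem9 _ _ (suc zero , refl) = χ≡3 1 Three.labeling₃ Three.antimagic₃ (≤-reflexive Three.colours₃)
mainTheorem9 _ _ (k@(suc (suc _)) , refl) = χ≡3 k (labeling k) (antimagic k (s≤s (s≤s z≤n))) (colours≤3 k (s≤s z≤n))
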